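{- Let $m,n\geqslant 7$, $i_1,\dots,i_m\in[n]$ distinct and $j_1,\dots,j_m\in[n]$ distinct, and let $S_0,\dots,S_m$ be as defined in the context. For every $k$ with $4\leqslant k\leqslant m$, every vertex in $S_k$ can be expressed as a linear combination of vertices in $S_{k-1}\cup S_{k-2}\cup S_{k-3}\cup S_{k-4}$.
   Context: $P_\sigma$ is the $n\times n$ permutation matrix of $\sigma\in S_n$ ($P_\sigma(i,j)=1$ iff $\sigma(i)=j$); $P^{[2]}_\sigma$ is the $n^2\times n^2$ matrix with rows/columns indexed by pairs $(ij)$ and $P^{[2]}_\sigma(ij,kl)=P_\sigma(i,j)P_\sigma(k,l)$; these are the vertices of $\mathrm{QAP}_n=\mathrm{conv}\{P^{[2]}_\sigma:\sigma\in S_n\}$. For $0\leqslant k\leqslant m$, $S_k$ is the set of vertices $P^{[2]}_\sigma$ such that $\sigma(i_r)=j_r$ for exactly $k$ indices $r\in[m]$. -}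

module Defs where

open import Data.Nat using (ℕ; _∸_)
open import Data.Fin using (Fin; _≟_)
open import Data.Fin.Permutation using (Permutation′; _⟨$⟩ʳ_)
open import Data.List using (List; []; _∷_; length; filter; allFin; foldr)
open import Data.Product using (_×_; _,_; ∃)
open import Data.Sum using (_⊎_)
open import Data.Rational using (ℚ; 0ℚ; 1ℚ; _+_; _*_)
open import Relation.Binary.PropositionalEquality using (_≡_)
open import Relation.Nullary using (does)

P : ∀ {n} → Permutation′ n → Fin n → Fin n → ℚ
P σ i j = if does ((σ ⟨$⟩ʳ i) ≟ j) then 1ℚ else 0ℚ
  where
  open import Data.Bool using (if_then_else_)

P2 : ∀ {n} → Permutation′ n → (Fin n × Fin n) → (Fin n × Fin n) → ℚ
P2 σ (i , j) (k , l) = P σ i j * P σ k l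

agree : ∀ {m n} → (Fin m → Fin n) → (Fin m → Fin n) → Permutation′ n → ℕ
agree {m} is js σ = length (filter (λ r → (σ ⟨$⟩ʳ is r) ≟ js r) (allFin m))

-- The vertex P^[2]_σ lies in S_k.
InS : ∀ {m n} → (Fin m → Fin n) → (Fin m → Fin n) → ℕ → Permutation′ n → Set
InS is js k σ = agree is js σ ≡ k

lincomb : ∀ {n} → List (ℚ × Permutation′ n) →
          (Fin n × Fin n) → (Fin n × Fin n) → ℚ
lincomb cs a b = foldr (λ { (c , τ) acc → c * P2 τ a b + acc }) 0ℚ cs

-- Fix four positions r₁,…,r₄ at which σ(i_r) = j_r, put eₜ = i_{rₜ}, and let each π ∈ S₄ act on
-- {e₁,…,e₄}, fixing all other points.  An entry of P^[2]_{σπ} only tests where π sends at most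
-- two of the eₜ, and the alternating sum of such a test over S₄ vanishes, since right
-- multiplication by a transposition of two untested points is a sign-reversing bijection.
-- Hence P^[2]_σ = ∑_{π ≠ id} (−sgn π) P^[2]_{σπ}.  Outside the eₜ the permutations σπ and σ
-- agree, and at eₜ the permutation σπ keeps the agreement iff π fixes t; so σπ lies in
-- S_{k−d} where 1 ≤ d ≤ 4 is the number of points moved by π.
module Submission where

open import Defs
open import Data.Bool using (Bool; true; false; if_then_else_)
open import Data.Fin using (Fin; zero; suc; _≟_; toℕ; inject≤)
open import Data.Fin.Permutation
  using (Permutation′; _⟨$⟩ʳ_; _⟨$⟩ˡ_; permutation; inverseˡ; inverseʳ; id; insert; _∘ₚ_)
open import Data.Fin.Properties using (all?; any?; inject≤-injective)
open import Data.List using (List; []; _∷_; [_]; map; concatMap; allFin; filter; foldr; length; lookup)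
open import Data.List.Membership.Propositional using (_∈_)
open import Data.List.Membership.Propositional.Properties using (∈-lookup; ∈-filter⁻; ∈-allFin)
open import Data.List.Properties using (filter-accept; filter-reject; filter-none)
open import Data.List.Relation.Binary.Sublist.Propositional using (⊆-refl)
open import Data.List.Relation.Binary.Sublist.Propositional.Properties using (length-mono-≤)
import Data.List.Relation.Binary.Sublist.Propositional.Properties as Sublist
open import Data.List.Relation.Unary.All using (All)
import Data.List.Relation.Unary.All as All
open import Data.List.Relation.Unary.All.Properties using (map⁺; all-filter)
open import Data.List.Relation.Unary.AllPairs using ([]; _∷_)
open import Data.List.Relation.Unary.Any using (here; there)
open import Data.List.Relation.Unary.Unique.Propositional using (Unique)
import Data.List.Relation.Unary.Unique.Propositional.Properties as Unique
open import Data.Nat using (ℕ; _≤_; _<_; _+_; _∸_; z≤n; s≤s)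
open import Data.Nat.Properties
  using (≤-trans; ≤-reflexive; +-suc; +-comm; +-monoʳ-≤; +-mono-≤; n≤1+n; m≤n⇒m≤1+n; m≤n⇒∃[o]m+o≡n; +-cancelʳ-≤)
open import Data.Product using (_×_; _,_; Σ; ∃; proj₂; map₁; map₂)
open import Data.Rational using (ℚ; 0ℚ; 1ℚ; _*_; -_)
import Data.Rational as ℚ
open import Data.Sum using (_⊎_; inj₁; inj₂)
open import Function using (_∘_)
open import Function.Bundles using (mk⇔)
open import Function.Definitions using (Injective)
open import Relation.Binary.Definitions using (DecidableEquality)
open import Relation.Binary.PropositionalEquality using (_≡_; _≢_; refl; sym; trans; cong; cong₂; subst; module ≡-Reasoning)
open import Relation.Nullary using (Dec; yes; no; does; ¬_; ¬?; contradiction)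
open import Relation.Nullary.Decidable using (toWitness; dec-false; does-⇔; _⊎-dec_)
open import Relation.Unary using (Decidable; _⊆_)

count : ∀ {A : Set} {P : A → Set} → Decidable P → List A → ℕ
count P? xs = length (filter P? xs)

module _ {A : Set} {P Q : A → Set} (P? : Decidable P) (Q? : Decidable Q) where

  count-mono : P ⊆ Q → ∀ xs → count P? xs ≤ count Q? xs
  count-mono P⊆Q xs = length-mono-≤ (Sublist.filter⁺ P? Q? {as = xs} {bs = xs} (λ { refl → P⊆Q }) ⊆-refl)

  count-mono-< : P ⊆ Q → ∀ {x xs} → x ∈ xs → ¬ P x → Q x → count P? xs < count Q? xs
  count-mono-< P⊆Q {xs = _ ∷ ys} (here refl) ¬Px Qx
    rewrite filter-reject P? {xs = ys} ¬Px | filter-accept Q? {xs = ys} Qx = s≤s (count-mono P⊆Q ys)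
  count-mono-< P⊆Q {xs = y ∷ _} (there x∈ys) ¬Px Qx with P? y | Q? y
  ... | yes _  | yes _   = s≤s (count-mono-< P⊆Q x∈ys ¬Px Qx)
  ... | yes Py | no ¬Qy  = contradiction (P⊆Q Py) ¬Qy
  ... | no _   | yes _   = m≤n⇒m≤1+n (count-mono-< P⊆Q x∈ys ¬Px Qx)
  ... | no _   | no _    = count-mono-< P⊆Q x∈ys ¬Px Qx

  count-⊎ : ∀ xs → count (λ x → P? x ⊎-dec Q? x) xs ≤ count P? xs + count Q? xs
  count-⊎ [] = z≤n
  count-⊎ (x ∷ xs) with P? x | Q? x
  ... | yes _ | yes _ = s≤s (≤-trans (count-⊎ xs) (+-monoʳ-≤ _ (n≤1+n _)))
  ... | yes _ | no _  = s≤s (count-⊎ xs)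
  ... | no _  | yes _ = ≤-trans (s≤s (count-⊎ xs)) (≤-reflexive (sym (+-suc _ _)))
  ... | no _  | no _  = count-⊎ xs

module _ {A : Set} (_≟ᴬ_ : DecidableEquality A) where

  count-≡-unique : ∀ c {xs} → Unique xs → count (c ≟ᴬ_) xs ≤ 1
  count-≡-unique c {[]} _ = z≤n
  count-≡-unique c {x ∷ xs} (x∉xs ∷ unique) with c ≟ᴬ x
  ... | yes refl = s≤s (≤-reflexive (cong length (filter-none (c ≟ᴬ_) {xs = xs} x∉xs)))
  ... | no _     = count-≡-unique c unique

  count-image-unique : ∀ {k} (f : Fin k → A) {xs} → Unique xs →
                       count (λ x → any? λ i → f i ≟ᴬ x) xs ≤ k
  count-image-unique {ℕ.zero} f {xs} _ =
    ≤-reflexive (cong length (filter-none (λ x → any? λ i → f i ≟ᴬ x) {xs = xs} (All.tabulate λ { _ (() , _) })))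
  count-image-unique {ℕ.suc k} f {xs} unique = begin
    count (λ x → any? λ i → f i ≟ᴬ x) xs
      ≤⟨ count-mono _ _ first-or-rest xs ⟩
    count (λ x → f zero ≟ᴬ x ⊎-dec any? λ i → f (suc i) ≟ᴬ x) xs
      ≤⟨ count-⊎ (f zero ≟ᴬ_) (λ x → any? λ i → f (suc i) ≟ᴬ x) xs ⟩
    count (f zero ≟ᴬ_) xs + count (λ x → any? λ i → f (suc i) ≟ᴬ x) xs
      ≤⟨ +-mono-≤ (count-≡-unique (f zero) unique) (count-image-unique (f ∘ suc) unique) ⟩
    ℕ.suc k ∎
    where
    open Data.Nat.Properties.≤-Reasoning
    first-or-rest : ∀ {x} → (∃ λ i → f i ≡ x) → f zero ≡ x ⊎ ∃ λ i → f (suc i) ≡ x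
    first-or-rest (zero , eq) = inj₁ eq
    first-or-rest (suc i , eq) = inj₂ (i , eq)

module _ {A : Set} where

  lookup-injective : ∀ {xs : List A} → Unique xs → Injective _≡_ _≡_ (lookup xs)
  lookup-injective {_ ∷ _} _ {zero} {zero} _ = refl
  lookup-injective {_ ∷ _} (x∉xs ∷ _) {zero} {suc j} eq = contradiction eq (All.lookup x∉xs (∈-lookup j))
  lookup-injective {_ ∷ _} (x∉xs ∷ _) {suc i} {zero} eq = contradiction (sym eq) (All.lookup x∉xs (∈-lookup i))
  lookup-injective {_ ∷ _} (_ ∷ unique) {suc i} {suc j} eq = cong suc (lookup-injective unique eq)

  distinct-members : ∀ {k} {xs : List A} → Unique xs → k ≤ length xs →
                     Σ (Fin k → A) λ f → Injective _≡_ _≡_ f × (∀ i → f i ∈ xs)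
  distinct-members {xs = xs} unique k≤∣xs∣ =
    (λ i → lookup xs (inject≤ i k≤∣xs∣)) ,
    (λ eq → inject≤-injective k≤∣xs∣ k≤∣xs∣ _ _ (lookup-injective unique eq)) ,
    (λ i → ∈-lookup (inject≤ i k≤∣xs∣))

weighted : ∀ {X : Set} → List (ℚ × X) → (X → ℚ) → ℚ
weighted cs f = foldr (λ (c , x) acc → c * f x ℚ.+ acc) 0ℚ cs

lincomb-map₂ : ∀ {n} {X : Set} (g : X → Permutation′ n) (f : X → ℚ) cs a b →
               (∀ x → P2 (g x) a b ≡ f x) → lincomb (map (map₂ g) cs) a b ≡ weighted cs f
lincomb-map₂ g f [] a b _ = refl
lincomb-map₂ g f ((c , x) ∷ cs) a b P2≡f =
  cong₂ (λ u v → c * u ℚ.+ v) (P2≡f x) (lincomb-map₂ g f cs a b P2≡f)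

_^_ : ℚ → ℕ → ℚ
q ^ ℕ.zero = 1ℚ
q ^ ℕ.suc n = q * q ^ n

-- Every permutation of Fin (suc k) is uniquely insert zero j π, of sign (−1)ʲ · sgn π.
signedPermutations : ∀ k → List (ℚ × Permutation′ k)
signedPermutations ℕ.zero = [ 1ℚ , id ]
signedPermutations (ℕ.suc k) =
  concatMap (λ (s , π) → map (λ j → (- 1ℚ) ^ toℕ j * s , insert zero j π) (allFin (ℕ.suc k)))
            (signedPermutations k)

Moved : ∀ {k} → Permutation′ k → Set
Moved π = ∃ λ i → π ⟨$⟩ʳ i ≢ i

moved? : ∀ {k} (π : Permutation′ k) → Dec (Moved π)
moved? π = any? λ i → ¬? (π ⟨$⟩ʳ i ≟ i)

nontrivial : ∀ {k} → List (ℚ × Permutation′ k) → List (ℚ × Permutation′ k)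
nontrivial cs = map (map₁ -_) (filter (moved? ∘ proj₂) cs)

nontrivial-moved : ∀ {k} (cs : List (ℚ × Permutation′ k)) → All (Moved ∘ proj₂) (nontrivial cs)
nontrivial-moved cs = map⁺ (all-filter (moved? ∘ proj₂) cs)

-- Opaque: unfolding the 23-term list during conversion checking is prohibitively slow.
opaque
  nontrivialTerms : List (ℚ × Permutation′ 4)
  nontrivialTerms = nontrivial (signedPermutations 4)

data Test (k : ℕ) : Set where
  _↦_   : Fin k → Fin k → Test k
  const : Bool → Test k

holds : ∀ {k} → Test k → Permutation′ k → Bool
holds (i ↦ j)   π = does (π ⟨$⟩ʳ i ≟ j)
holds (const b) _ = b

𝟙 : Bool → ℚ
𝟙 b = if b then 1ℚ else 0ℚ

Balanced : Test 4 → Test 4 → Set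
Balanced s t = 𝟙 (holds s id) * 𝟙 (holds t id)
             ≡ weighted nontrivialTerms (λ π → 𝟙 (holds s π) * 𝟙 (holds t π))

balanced? : ∀ s t → Dec (Balanced s t)
balanced? s t = _ ℚ.≟ _

opaque
  unfolding nontrivialTerms

  balanced : ∀ s t → Balanced s t
  balanced (i ↦ j) (k ↦ l) =
    toWitness {a? = all? λ i → all? λ j → all? λ k → all? λ l → balanced? (i ↦ j) (k ↦ l)} _ i j k l
  balanced (i ↦ j) (const true) = toWitness {a? = all? λ i → all? λ j → balanced? (i ↦ j) (const true)} _ i j
  balanced (i ↦ j) (const false) = toWitness {a? = all? λ i → all? λ j → balanced? (i ↦ j) (const false)} _ i j
  balanced (const true) (k ↦ l) = toWitness {a? = all? λ k → all? λ l → balanced? (const true) (k ↦ l)} _ k l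
  balanced (const false) (k ↦ l) = toWitness {a? = all? λ k → all? λ l → balanced? (const false) (k ↦ l)} _ k l
  balanced (const true) (const true) = refl
  balanced (const true) (const false) = refl
  balanced (const false) (const true) = refl
  balanced (const false) (const false) = refl

  nontrivialTerms-moved : All (Moved ∘ proj₂) nontrivialTerms
  nontrivialTerms-moved = nontrivial-moved (signedPermutations 4)

does-⟨$⟩ʳ : ∀ {n} (σ : Permutation′ n) x y → does (σ ⟨$⟩ʳ x ≟ y) ≡ does (x ≟ σ ⟨$⟩ˡ y)
does-⟨$⟩ʳ σ x y = does-⇔ (mk⇔ (λ { refl → sym (inverseˡ σ) }) (λ { refl → inverseʳ σ })) (σ ⟨$⟩ʳ x ≟ y) (x ≟ σ ⟨$⟩ˡ y)

P-cong : ∀ {n} (σ τ : Permutation′ n) {a} b → σ ⟨$⟩ʳ a ≡ τ ⟨$⟩ʳ a → P σ a b ≡ P τ a b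
P-cong σ τ b σa≡τa = cong (λ x → 𝟙 (does (x ≟ b))) σa≡τa

module Extension {k n} (e : Fin k → Fin n) (e-injective : Injective _≡_ _≡_ e) where

  preimage? : ∀ x → Dec (∃ λ i → e i ≡ x)
  preimage? x = any? λ i → e i ≟ x

  extendFun : (Fin k → Fin k) → Fin n → Fin n
  extendFun f x with preimage? x
  ... | yes (i , _) = e (f i)
  ... | no _        = x

  extendFun-image : ∀ f i → extendFun f (e i) ≡ e (f i)
  extendFun-image f i with preimage? (e i)
  ... | yes (j , ej≡ei) = cong (e ∘ f) (e-injective ej≡ei)
  ... | no ∄            = contradiction (i , refl) ∄

  extendFun-outside : ∀ f {x} → ¬ (∃ λ i → e i ≡ x) → extendFun f x ≡ x
  extendFun-outside f {x} ∄ with preimage? x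
  ... | yes found = contradiction found ∄
  ... | no _      = refl

  extendFun-inverse : ∀ {f g} → (∀ i → f (g i) ≡ i) → ∀ x → extendFun f (extendFun g x) ≡ x
  extendFun-inverse {f} {g} fg x with preimage? x
  ... | yes (i , ei≡x) = trans (extendFun-image f (g i)) (trans (cong e (fg i)) ei≡x)
  ... | no ∄           = extendFun-outside f ∄

  extend : Permutation′ k → Permutation′ n
  extend π = permutation (extendFun (π ⟨$⟩ʳ_)) (extendFun (π ⟨$⟩ˡ_))
                         (extendFun-inverse (λ _ → inverseʳ π)) (extendFun-inverse (λ _ → inverseˡ π))

  extend-id : ∀ x → extend id ⟨$⟩ʳ x ≡ x
  extend-id x with preimage? x
  ... | yes (_ , ei≡x) = ei≡x
  ... | no _           = refl

  test : Fin n → Fin n → Test k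
  test a b with preimage? a | preimage? b
  ... | yes (i , _) | yes (j , _) = i ↦ j
  ... | yes _       | no _        = const false
  ... | no _        | yes _       = const false
  ... | no _        | no _        = const (does (a ≟ b))

  extend-≟ : ∀ π a b → does (extend π ⟨$⟩ʳ a ≟ b) ≡ holds (test a b) π
  extend-≟ π a b with preimage? a | preimage? b
  ... | yes (i , refl) | yes (j , refl) = does-⇔ (mk⇔ e-injective (cong e)) (e (π ⟨$⟩ʳ i) ≟ e j) (π ⟨$⟩ʳ i ≟ j)
  ... | yes (i , refl) | no ∄b          = dec-false (e (π ⟨$⟩ʳ i) ≟ b) λ eq → ∄b (π ⟨$⟩ʳ i , eq)
  ... | no ∄a          | yes (j , refl) = dec-false (a ≟ e j) λ eq → ∄a (j , sym eq)
  ... | no _           | no _           = refl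

  P-extend : ∀ σ π a b → P (extend π ∘ₚ σ) a b ≡ 𝟙 (holds (test a (σ ⟨$⟩ˡ b)) π)
  P-extend σ π a b = cong 𝟙 (trans (does-⟨$⟩ʳ σ (extend π ⟨$⟩ʳ a) b) (extend-≟ π a (σ ⟨$⟩ˡ b)))

  P-unextended : ∀ σ a b → P σ a b ≡ 𝟙 (holds (test a (σ ⟨$⟩ˡ b)) id)
  P-unextended σ a b = trans (P-cong σ (extend id ∘ₚ σ) b (cong (σ ⟨$⟩ʳ_) (sym (extend-id a)))) (P-extend σ id a b)

module _ {n} (σ : Permutation′ n) (e : Fin 4 → Fin n) (e-injective : Injective _≡_ _≡_ e) where
  open Extension e e-injective

  P2-expansion : ∀ a b → P2 σ a b ≡ lincomb (map (map₂ (λ π → extend π ∘ₚ σ)) nontrivialTerms) a b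
  P2-expansion (a , b) (c , d) = begin
    P σ a b * P σ c d
      ≡⟨ cong₂ _*_ (P-unextended σ a b) (P-unextended σ c d) ⟩
    𝟙 (holds s id) * 𝟙 (holds t id)
      ≡⟨ balanced s t ⟩
    weighted nontrivialTerms (λ π → 𝟙 (holds s π) * 𝟙 (holds t π))
      ≡⟨ lincomb-map₂ (λ π → extend π ∘ₚ σ) (λ π → 𝟙 (holds s π) * 𝟙 (holds t π)) nontrivialTerms (a , b) (c , d)
           (λ π → cong₂ _*_ (P-extend σ π a b) (P-extend σ π c d)) ⟨
    lincomb (map (map₂ (λ π → extend π ∘ₚ σ)) nontrivialTerms) (a , b) (c , d) ∎
    where
    open ≡-Reasoning
    s t : Test 4
    s = test a (σ ⟨$⟩ˡ b)
    t = test c (σ ⟨$⟩ˡ d)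

module _ {m n} (is js : Fin m → Fin n) where

  agrees? : (σ : Permutation′ n) (r : Fin m) → Dec (σ ⟨$⟩ʳ is r ≡ js r)
  agrees? σ r = σ ⟨$⟩ʳ is r ≟ js r

  agreeing-positions : ∀ σ {k} → k ≤ agree is js σ →
                       Σ (Fin k → Fin m) λ ρ → Injective _≡_ _≡_ ρ × (∀ i → σ ⟨$⟩ʳ is (ρ i) ≡ js (ρ i))
  agreeing-positions σ k≤agree =
    let ρ , ρ-injective , ρ-agreeing = distinct-members (Unique.filter⁺ (agrees? σ) (Unique.allFin⁺ m)) k≤agree
    in ρ , ρ-injective , λ i → proj₂ (∈-filter⁻ (agrees? σ) {xs = allFin m} (ρ-agreeing i))

  module Agreement {k} (is-injective : Injective _≡_ _≡_ is) (js-injective : Injective _≡_ _≡_ js)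
                   (σ : Permutation′ n) (ρ : Fin k → Fin m) (ρ-injective : Injective _≡_ _≡_ ρ)
                   (σ-agrees : ∀ i → σ ⟨$⟩ʳ is (ρ i) ≡ js (ρ i)) where
    open Extension (is ∘ ρ) (ρ-injective ∘ is-injective) public

    agrees-extend⇒agrees : ∀ π {r} → extend π ∘ₚ σ ⟨$⟩ʳ is r ≡ js r → σ ⟨$⟩ʳ is r ≡ js r
    agrees-extend⇒agrees π {r} τ-agrees with preimage? (is r)
    ... | yes (i , isρi≡isr) = subst (λ r → σ ⟨$⟩ʳ is r ≡ js r) (is-injective isρi≡isr) (σ-agrees i)
    ... | no _                = τ-agrees

    agrees⇒agrees-extend : ∀ π {r} → σ ⟨$⟩ʳ is r ≡ js r →
                           extend π ∘ₚ σ ⟨$⟩ʳ is r ≡ js r ⊎ ∃ λ i → ρ i ≡ r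
    agrees⇒agrees-extend π {r} σ-agrees-r with preimage? (is r)
    ... | yes (i , isρi≡isr) = inj₂ (i , is-injective isρi≡isr)
    ... | no _                = inj₁ σ-agrees-r

    moved⇒disagrees : ∀ π {i} → π ⟨$⟩ʳ i ≢ i → extend π ∘ₚ σ ⟨$⟩ʳ is (ρ i) ≢ js (ρ i)
    moved⇒disagrees π {i} π-moves-i τ-agrees = π-moves-i (ρ-injective (js-injective (begin
      js (ρ (π ⟨$⟩ʳ i))                 ≡⟨ σ-agrees (π ⟨$⟩ʳ i) ⟨
      σ ⟨$⟩ʳ is (ρ (π ⟨$⟩ʳ i))           ≡⟨ cong (σ ⟨$⟩ʳ_) (extendFun-image (π ⟨$⟩ʳ_) i) ⟨
      extend π ∘ₚ σ ⟨$⟩ʳ is (ρ i)        ≡⟨ τ-agrees ⟩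
      js (ρ i)                          ∎)))
      where open ≡-Reasoning

    agree-extend-< : ∀ π → Moved π → agree is js (extend π ∘ₚ σ) < agree is js σ
    agree-extend-< π (i , π-moves-i) =
      count-mono-< (agrees? (extend π ∘ₚ σ)) (agrees? σ) (agrees-extend⇒agrees π)
                   (∈-allFin (ρ i)) (moved⇒disagrees π π-moves-i) (σ-agrees i)

    agree-≤-agree-extend-+ : ∀ π → agree is js σ ≤ agree is js (extend π ∘ₚ σ) + k
    agree-≤-agree-extend-+ π = begin
      count (agrees? σ) (allFin m)
        ≤⟨ count-mono (agrees? σ) (λ r → agrees? (extend π ∘ₚ σ) r ⊎-dec chosen? r)
                      (agrees⇒agrees-extend π) (allFin m) ⟩
      count (λ r → agrees? (extend π ∘ₚ σ) r ⊎-dec chosen? r) (allFin m)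
        ≤⟨ count-⊎ (agrees? (extend π ∘ₚ σ)) chosen? (allFin m) ⟩
      count (agrees? (extend π ∘ₚ σ)) (allFin m) + count chosen? (allFin m)
        ≤⟨ +-monoʳ-≤ _ (count-image-unique _≟_ ρ (Unique.allFin⁺ m)) ⟩
      count (agrees? (extend π ∘ₚ σ)) (allFin m) + k ∎
      where
      open Data.Nat.Properties.≤-Reasoning
      chosen? : ∀ r → Dec (∃ λ i → ρ i ≡ r)
      chosen? r = any? λ i → ρ i ≟ r

FourBelow : ℕ → ℕ → Set
FourBelow k x = x ≡ k ∸ 1 ⊎ x ≡ k ∸ 2 ⊎ x ≡ k ∸ 3 ⊎ x ≡ k ∸ 4

four-below : ∀ {x k} → x < k → k ≤ x + 4 → FourBelow k x
four-below {x} {k} x<k k≤x+4 with m≤n⇒∃[o]m+o≡n x<k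
... | d , 1+x+d≡k = subst (λ k → FourBelow k x) d+1+x≡k (gap d d≤3)
  where
  d+1+x≡k : d + ℕ.suc x ≡ k
  d+1+x≡k = trans (+-comm d (ℕ.suc x)) 1+x+d≡k

  d≤3 : d ≤ 3
  d≤3 = +-cancelʳ-≤ (ℕ.suc x) d 3
          (≤-trans (≤-reflexive d+1+x≡k) (≤-trans k≤x+4 (≤-reflexive (+-comm x 4))))

  gap : ∀ d → d ≤ 3 → FourBelow (d + ℕ.suc x) x
  gap 0 _ = inj₁ refl
  gap 1 _ = inj₂ (inj₁ refl)
  gap 2 _ = inj₂ (inj₂ (inj₁ refl))
  gap 3 _ = inj₂ (inj₂ (inj₂ refl))
  gap (ℕ.suc (ℕ.suc (ℕ.suc (ℕ.suc _)))) (s≤s (s≤s (s≤s ())))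

lemma3 : (m n : ℕ) → 7 ≤ m → 7 ≤ n →
    (is js : Fin m → Fin n) → Injective _≡_ _≡_ is → Injective _≡_ _≡_ js →
    (k : ℕ) → 4 ≤ k → k ≤ m →
    (σ : Permutation′ n) → InS is js k σ →
    Σ (List (ℚ × Permutation′ n)) λ cs →
      All (λ cτ → InS is js (k ∸ 1) (proj₂ cτ) ⊎ InS is js (k ∸ 2) (proj₂ cτ)
                  ⊎ InS is js (k ∸ 3) (proj₂ cτ) ⊎ InS is js (k ∸ 4) (proj₂ cτ)) cs
      × (∀ a b → P2 σ a b ≡ lincomb cs a b)
lemma3 m n _ _ is js is-injective js-injective k 4≤k _ σ σ∈Sₖ
  with agreeing-positions is js σ (subst (4 ≤_) (sym σ∈Sₖ) 4≤k)
... | ρ , ρ-injective , ρ-agrees =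
  map (map₂ (λ π → extend π ∘ₚ σ)) nontrivialTerms ,
  all-nearby nontrivialTerms-moved ,
  P2-expansion σ (is ∘ ρ) (ρ-injective ∘ is-injective)
  where
  open Agreement is js is-injective js-injective σ ρ ρ-injective ρ-agrees

  nearby : ∀ π → Moved π → FourBelow k (agree is js (extend π ∘ₚ σ))
  nearby π π-moved = four-below (subst (agree is js (extend π ∘ₚ σ) <_) σ∈Sₖ (agree-extend-< π π-moved))
                                (subst (_≤ agree is js (extend π ∘ₚ σ) + 4) σ∈Sₖ (agree-≤-agree-extend-+ π))

  all-nearby : ∀ {cs : List (ℚ × Permutation′ 4)} → All (Moved ∘ proj₂) cs →
               All (λ cτ → FourBelow k (agree is js (proj₂ cτ))) (map (map₂ (λ π → extend π ∘ₚ σ)) cs)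
  all-nearby = map⁺ ∘ All.map (λ {(_ , π)} → nearby π)
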